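{- Let $n\ge k\ge 2$, $c\ge 2$, $1\le s\le c-1$, let $t=\lceil sk/c\rceil$, and let $\lambda\in[c]$ satisfy $\lambda\equiv sk\pmod c$. If $n\ge n_0=\left(\binom{k}{t}-m(k,t,\lambda;s+1,c-s+1)\right)t+t-1$, then \[f_{c,s}(n,k)\le\frac{\binom{n}{t}}{\binom{k}{t}-m(k,t,\lambda;s+1,c-s+1)}.\]
   Context: $[m]=\{1,\dots,m\}$; $\binom{X}{k}$ is the family of $k$-subsets of $X$. A hypergraph $\mathcal{F}\subseteq 2^{[n]}$ is $(c,s)$-frameproof if for every $c+1$ edges $A_0,A_1,\dots,A_c\in\mathcal{F}$ with $A_0\neq A_j$ for each $j\in[c]$ ($A_1,\dots,A_c$ not necessarily distinct), there is some $i\in A_0$ with $|\{j\in[c]:i\in A_j\}|<s$. $f_{c,s}(n,k)$ is the maximum size of a $(c,s)$-frameproof $\mathcal{F}\subseteq\binom{[n]}{k}$. A sequence $A_1,\dots,A_\lambda$ of subsets of $[k]$ (repetitions allowed) is $(k_1,k_2)$-disjoint if $\bigcap_{i\in B}A_i=\emptyset$ for every $k_1$-subset $B\subseteq[\lambda]$ and $\bigcup_{i\in B}A_i=[k]$ for every $k_2$-subset $B\subseteq[\lambda]$ (each condition vacuous if the subset size exceeds $\lambda$). $m(k,t,\lambda;k_1,k_2)$ is the maximum size of $\mathcal{F}\subseteq\binom{[k]}{t}$ containing no $A_1,\dots,A_\lambda\in\mathcal{F}$ (not necessarily distinct) forming a $(k_1,k_2)$-disjoint sequence. -}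

module Defs where

open import Data.Nat using (ℕ; zero; suc; _+_; _*_; _/_; _≤_)
open import Data.Fin using (Fin)
open import Data.Fin.Subset using (Subset; _∈_; _∉_; ∣_∣)
open import Data.Vec using (tabulate; lookup)
open import Data.List using (List; length)
open import Data.List.Relation.Unary.All using (All)
open import Data.List.Relation.Unary.Unique.Propositional using (Unique)
import Data.List.Membership.Propositional as L
open import Data.Product using (Σ; ∃; _×_)
open import Data.Sum using (_⊎_)
open import Relation.Binary.PropositionalEquality using (_≡_; _≢_)
open import Relation.Nullary using (¬_)

-- ceiling division ⌈ a / c ⌉ (junk value 0 for c = 0, never used)
ceilDiv : ℕ → ℕ → ℕ
ceilDiv a zero    = 0
ceilDiv a (suc c) = (a + c) / suc c

_≡_[mod_] : ℕ → ℕ → ℕ → Set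
a ≡ b [mod c ] = ∃ λ q → (a + q * c ≡ b) ⊎ (b + q * c ≡ a)

-- A family of k-subsets of [n]: a duplicate-free list of subsets of Fin n, each of size k.
-- Its size is the length of the list.
record Family (n k : ℕ) : Set where
  constructor family
  field
    sets    : List (Subset n)
    unique  : Unique sets
    uniform : All (λ A → ∣ A ∣ ≡ k) sets
open Family public

count : {n c : ℕ} → Fin n → (Fin c → Subset n) → ℕ
count i As = ∣ tabulate (λ j → lookup (As j) i) ∣

Frameproof : {n k : ℕ} → ℕ → ℕ → Family n k → Set
Frameproof {n} c s F =
  (A₀ : Subset n) → (As : Fin c → Subset n) →
  A₀ L.∈ sets F → (∀ j → As j L.∈ sets F) → (∀ j → A₀ ≢ As j) →
  Σ (Fin n) λ i → (i ∈ A₀) × (count i As Data.Nat.< s)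

Disjoint : {k λ' : ℕ} → ℕ → ℕ → (Fin λ' → Subset k) → Set
Disjoint {k} {λ'} k₁ k₂ A =
  ((B : Subset λ') → ∣ B ∣ ≡ k₁ → (x : Fin k) → ¬ (∀ j → j ∈ B → x ∈ A j)) ×
  ((B : Subset λ') → ∣ B ∣ ≡ k₂ → (x : Fin k) → Σ (Fin λ') λ j → (j ∈ B) × (x ∈ A j))

NoDisjoint : {k t : ℕ} → ℕ → ℕ → ℕ → Family k t → Set
NoDisjoint {k} λ' k₁ k₂ G =
  ¬ (Σ (Fin λ' → Subset k) λ A → (∀ j → A j L.∈ sets G) × Disjoint k₁ k₂ A)

IsM : ℕ → ℕ → ℕ → ℕ → ℕ → ℕ → Set
IsM k t λ' k₁ k₂ M =
  (Σ (Family k t) λ G → NoDisjoint λ' k₁ k₂ G × length (sets G) ≡ M) ×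
  ((G : Family k t) → NoDisjoint λ' k₁ k₂ G → length (sets G) ≤ M)

module Submission where

-- Write t = t′ + 1, so that s k = t′ c + λ. Say that A ∈ F owns X ⊆ A if no other member of F
-- contains X, and that A claims a pair (T , i) with ∣ T ∣ = t and i ∈ T if A owns T or T - i.
-- Since T - i ⊆ T, a pair has at most one claimant, so at most C(n,t) t pairs are claimed.
-- Every A ∈ F claims at least (C(k,t) - M) t pairs. If A owns some t′-set S, it claims
-- (S + i , i) for each of the n - t′ points i ∉ S, and n - t′ ≥ (C(k,t) - M) t is the bound
-- on n. Otherwise, let T₁ … T_λ be t-subsets of A not owned by A which, read as subsets of
-- [k], form an (s+1, c-s+1)-disjoint sequence. Then every point of A lies in between
-- s - (c - λ) and s of them, so the deficits sum to s k - λ t = (c - λ) t′ and can be covered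
-- by c - λ further t′-subsets of A, which are not owned either. Replacing each of these c
-- sets by another member of F containing it contradicts (c,s)-frameproofness. Hence the
-- non-owned t-subsets of A number at most M, and each of the other C(k,t) - M ones yields
-- t claims.

open import Defs
open import Data.Bool using (Bool; true; false; not; _∧_)
import Data.Bool as Bool
open import Data.Bool.Properties using (¬-not; ∧-zeroʳ)
open import Data.Fin using (Fin; zero; suc; splitAt)
open import Data.Fin.Subset
open import Data.Fin.Subset.Properties
  using (_∈?_; _⊆?_; anySubset?; ⊆-refl; ⊆-trans; ⊆-max; ⊥⊆; out⊆; in⊆in; s⊆s; drop-∷-⊆;
         p⊆q⇒∣p∣≤∣q∣; ∣⊥∣≡0; ∣⊤∣≡n; ∣∁p∣≡n∸∣p∣; x∈∁p⇒x∉p)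
open import Data.List using (List; []; _∷_; _++_; map; length; filter)
open import Data.List.Membership.Propositional using (find) renaming (_∈_ to _∈ˡ_)
open import Data.List.Membership.Propositional.Properties
  using (∈-map⁺; ∈-map⁻; ∈-++⁺ˡ; ∈-++⁺ʳ; ∈-filter⁻)
open import Data.List.Properties using (length-map)
open import Data.List.Relation.Unary.All as All using (All; []; _∷_; all?)
import Data.List.Relation.Unary.All.Properties as All
open import Data.List.Relation.Unary.AllPairs using ([]; _∷_)
open import Data.List.Relation.Unary.Any using (here; there)
open import Data.List.Relation.Unary.Unique.Propositional using (Unique)
import Data.List.Relation.Unary.Unique.Propositional.Properties as Unique
open import Data.Nat
open import Data.Nat.Combinatorics using (_C_; nCk+nC[k+1]≡[n+1]C[k+1])
open import Data.Nat.Divisibility using (n∣m*n)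
open import Data.Nat.DivMod using (_/_; +-distrib-/-∣ʳ; m<n⇒m/n≡0; m*n/n≡m)
open import Data.Nat.Properties
open import Data.Nat.Tactic.RingSolver using (solve-∀)
open import Algebra.Properties.CommutativeSemigroup +-commutativeSemigroup
  using (interchange; x∙yz≈y∙xz; x∙yz≈xz∙y)
open import Algebra.Properties.Semiring.Sum +-*-semiring
  using (sum-syntax; sum-cong-≗; sum-replicate-zero; ∑-distrib-+; ∑-comm; *-distribʳ-sum)
open import Data.Product using (∃; _×_; _,_; proj₁; proj₂)
open import Data.Sum using (_⊎_; inj₁; inj₂; [_,_]′)
import Data.Sum as Sum
open import Data.Vec using ([]; _∷_; here; there; lookup; tabulate; _[_]≔_)
open import Data.Vec.Properties
  using (≡-dec; ∷-injectiveˡ; ∷-injectiveʳ; lookup∘tabulate; tabulate-cong; []=⇒lookup; lookup⇒[]=;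
         []≔-idempotent; []≔-lookup; []≔-updates)
open import Data.Vec.Functional as Vector using (Vector)
open import Function using (_∘_)
open import Relation.Binary.PropositionalEquality
open import Relation.Nullary using (Dec; yes; no; does; ¬_; ¬?; contradiction)
open import Relation.Nullary.Decidable using (_×-dec_; _⊎-dec_; _→-dec_; map′; dec-true; dec-false)
open import Relation.Unary using (Pred; Decidable)

private variable n m l : ℕ

-- Finite sums

𝟙 : Bool → ℕ
𝟙 true  = 1
𝟙 false = 0

𝟙-∧-split : ∀ a b → 𝟙 (a ∧ b) + 𝟙 (a ∧ not b) ≡ 𝟙 a
𝟙-∧-split true  true  = refl
𝟙-∧-split true  false = refl
𝟙-∧-split false _     = refl

∑-mono-≤ : {f g : Fin n → ℕ} → (∀ i → f i ≤ g i) → ∑[ i < n ] f i ≤ ∑[ i < n ] g i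
∑-mono-≤ {zero}  f≤g = z≤n
∑-mono-≤ {suc n} f≤g = +-mono-≤ (f≤g zero) (∑-mono-≤ (λ i → f≤g (suc i)))

∑-const : ∀ n c → ∑[ i < n ] c ≡ n * c
∑-const zero    c = refl
∑-const (suc n) c = cong (c +_) (∑-const n c)

∑-++ : ∀ {A : Set} (f : A → ℕ) (U : Vector A l) (V : Vector A m) →
       ∑[ j < l + m ] f ((U Vector.++ V) j) ≡ ∑[ j < l ] f (U j) + ∑[ j < m ] f (V j)
∑-++ {l = zero}      f U V = refl
∑-++ {l = suc l} {m} f U V = trans (cong (f (U zero) +_) tail≡) (sym (+-assoc (f (U zero)) _ _))
  where
  ++-suc : ∀ j → (U Vector.++ V) (suc j) ≡ ((U ∘ suc) Vector.++ V) j
  ++-suc j with splitAt l j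
  ... | inj₁ _ = refl
  ... | inj₂ _ = refl
  tail≡ : ∑[ j < l + m ] f ((U Vector.++ V) (suc j)) ≡ ∑[ j < l ] f (U (suc j)) + ∑[ j < m ] f (V j)
  tail≡ = trans (sum-cong-≗ (cong f ∘ ++-suc)) (∑-++ f (U ∘ suc) V)

module _ {a} {A : Set a} where

  infixl 10 ∑ˡ
  ∑ˡ : List A → (A → ℕ) → ℕ
  ∑ˡ []       f = 0
  ∑ˡ (x ∷ xs) f = f x + ∑ˡ xs f

  syntax ∑ˡ xs (λ x → e) = ∑[ x ∈ xs ] e

  ∑ˡ-++ : ∀ xs ys (f : A → ℕ) → ∑[ x ∈ xs ++ ys ] f x ≡ ∑[ x ∈ xs ] f x + ∑[ x ∈ ys ] f x
  ∑ˡ-++ []       ys f = refl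
  ∑ˡ-++ (x ∷ xs) ys f = trans (cong (f x +_) (∑ˡ-++ xs ys f)) (sym (+-assoc (f x) _ _))

  ∑ˡ-zero : ∀ xs {f : A → ℕ} → (∀ {x} → x ∈ˡ xs → f x ≡ 0) → ∑[ x ∈ xs ] f x ≡ 0
  ∑ˡ-zero []       f≡0 = refl
  ∑ˡ-zero (x ∷ xs) f≡0 = cong₂ _+_ (f≡0 (here refl)) (∑ˡ-zero xs (λ y∈xs → f≡0 (there y∈xs)))

  ∑ˡ-cong : ∀ xs {f g : A → ℕ} → (∀ x → f x ≡ g x) → ∑[ x ∈ xs ] f x ≡ ∑[ x ∈ xs ] g x
  ∑ˡ-cong []       f≗g = refl
  ∑ˡ-cong (x ∷ xs) f≗g = cong₂ _+_ (f≗g x) (∑ˡ-cong xs f≗g)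

  ∑ˡ-mono-≤ : ∀ xs {f g : A → ℕ} → (∀ {x} → x ∈ˡ xs → f x ≤ g x) →
              ∑[ x ∈ xs ] f x ≤ ∑[ x ∈ xs ] g x
  ∑ˡ-mono-≤ []       f≤g = z≤n
  ∑ˡ-mono-≤ (x ∷ xs) f≤g = +-mono-≤ (f≤g (here refl)) (∑ˡ-mono-≤ xs (λ x∈xs → f≤g (there x∈xs)))

  ∈⇒≤∑ˡ : ∀ {xs y} (f : A → ℕ) → y ∈ˡ xs → f y ≤ ∑[ x ∈ xs ] f x
  ∈⇒≤∑ˡ         f (here refl)  = m≤m+n _ _
  ∈⇒≤∑ˡ {x ∷ _} f (there y∈xs) = ≤-trans (∈⇒≤∑ˡ f y∈xs) (m≤n+m _ (f x))

  ∑ˡ-distrib-+ : ∀ xs (f g : A → ℕ) →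
                 ∑[ x ∈ xs ] (f x + g x) ≡ ∑[ x ∈ xs ] f x + ∑[ x ∈ xs ] g x
  ∑ˡ-distrib-+ []       f g = refl
  ∑ˡ-distrib-+ (x ∷ xs) f g =
    trans (cong (f x + g x +_) (∑ˡ-distrib-+ xs f g)) (interchange (f x) (g x) _ _)

  *-distribʳ-∑ˡ : ∀ xs (f : A → ℕ) c → ∑[ x ∈ xs ] f x * c ≡ ∑[ x ∈ xs ] (f x * c)
  *-distribʳ-∑ˡ []       f c = refl
  *-distribʳ-∑ˡ (x ∷ xs) f c = trans (*-distribʳ-+ c (f x) _) (cong (f x * c +_) (*-distribʳ-∑ˡ xs f c))

  ∑ˡ-const : ∀ xs c → ∑[ x ∈ xs ] c ≡ length xs * c
  ∑ˡ-const []       c = refl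
  ∑ˡ-const (x ∷ xs) c = cong (c +_) (∑ˡ-const xs c)

  ∑ˡ-∑-comm : ∀ xs (f : A → Fin n → ℕ) →
              ∑[ x ∈ xs ] ∑[ i < n ] f x i ≡ ∑[ i < n ] ∑[ x ∈ xs ] f x i
  ∑ˡ-∑-comm {n} []       f = sym (sum-replicate-zero n)
  ∑ˡ-∑-comm     (x ∷ xs) f = trans (cong (_ +_) (∑ˡ-∑-comm xs f)) (sym (∑-distrib-+ (f x) _))

  length-filter≡∑𝟙 : ∀ {p} {P : Pred A p} (P? : Decidable P) xs →
                     length (filter P? xs) ≡ ∑[ x ∈ xs ] 𝟙 (does (P? x))
  length-filter≡∑𝟙 P? []       = refl
  length-filter≡∑𝟙 P? (x ∷ xs) with does (P? x)
  ... | true  = cong suc (length-filter≡∑𝟙 P? xs)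
  ... | false = length-filter≡∑𝟙 P? xs

  ∑ˡ-𝟙≤1 : ∀ {p} {P : Pred A p} (P? : Decidable P) {xs} → Unique xs →
           (∀ {x y} → x ∈ˡ xs → y ∈ˡ xs → P x → P y → x ≡ y) → ∑[ x ∈ xs ] 𝟙 (does (P? x)) ≤ 1
  ∑ˡ-𝟙≤1 P? {[]}     []           atMostOne = z≤n
  ∑ˡ-𝟙≤1 P? {x ∷ xs} (x∉xs ∷ uxs) atMostOne with P? x
  ... | no  _  = ∑ˡ-𝟙≤1 P? uxs (λ y∈ z∈ → atMostOne (there y∈) (there z∈))
  ... | yes Px = ≤-reflexive (cong suc (∑ˡ-zero xs none))
    where
    none : ∀ {y} → y ∈ˡ xs → 𝟙 (does (P? y)) ≡ 0
    none {y} y∈xs with P? y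
    ... | yes Py = contradiction (atMostOne (here refl) (there y∈xs) Px Py) (All.lookup x∉xs y∈xs)
    ... | no  _  = refl

module _ {a b} {A : Set a} {B : Set b} where

  ∑ˡ-map : ∀ (g : A → B) xs (f : B → ℕ) → ∑[ y ∈ map g xs ] f y ≡ ∑[ x ∈ xs ] f (g x)
  ∑ˡ-map g []       f = refl
  ∑ˡ-map g (x ∷ xs) f = cong (f (g x) +_) (∑ˡ-map g xs f)

  ∑ˡ-comm : ∀ xs ys (f : A → B → ℕ) →
            ∑[ x ∈ xs ] ∑[ y ∈ ys ] f x y ≡ ∑[ y ∈ ys ] ∑[ x ∈ xs ] f x y
  ∑ˡ-comm []       ys f = sym (∑ˡ-zero ys (λ _ → refl))
  ∑ˡ-comm (x ∷ xs) ys f = trans (cong (_ +_) (∑ˡ-comm xs ys f)) (sym (∑ˡ-distrib-+ ys (f x) _))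

  map⁺-injectiveOn : ∀ {p} {P : A → Set p} {f : A → B} {xs} →
                     (∀ {x y} → P x → P y → f x ≡ f y → x ≡ y) → All P xs → Unique xs → Unique (map f xs)
  map⁺-injectiveOn inj []         []           = []
  map⁺-injectiveOn inj (px ∷ pxs) (x∉xs ∷ uxs) =
    All.map⁺ (All.zipWith (λ (py , x≢y) fx≡fy → x≢y (inj px py fx≡fy)) (pxs , x∉xs))
    ∷ map⁺-injectiveOn inj pxs uxs

-- Subsets of Fin n

∣x∷p∣ : ∀ x (p : Subset n) → ∣ x ∷ p ∣ ≡ 𝟙 x + ∣ p ∣
∣x∷p∣ inside  p = refl
∣x∷p∣ outside p = refl

∣p∣≡∑ : (p : Subset n) → ∣ p ∣ ≡ ∑[ i < n ] 𝟙 (lookup p i)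
∣p∣≡∑ []            = refl
∣p∣≡∑ (inside  ∷ p) = cong suc (∣p∣≡∑ p)
∣p∣≡∑ (outside ∷ p) = ∣p∣≡∑ p

𝟙-lookup-mono : ∀ {P Q : Subset n} → P ⊆ Q → ∀ i → 𝟙 (lookup P i) ≤ 𝟙 (lookup Q i)
𝟙-lookup-mono {P = P} P⊆Q i with lookup P i in Pi≡
... | false = z≤n
... | true  rewrite []=⇒lookup (P⊆Q (lookup⇒[]= i P Pi≡)) = ≤-refl

select : ∀ {p} {P : Pred (Fin n) p} → Decidable P → Subset n
select P? = tabulate (λ i → does (P? i))

module _ {p} {P : Pred (Fin n) p} (P? : Decidable P) where

  ∈-select⁺ : ∀ {i} → P i → i ∈ select P?
  ∈-select⁺ {i} Pi = lookup⇒[]= i _ (trans (lookup∘tabulate _ i) (dec-true (P? i) Pi))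

  ∈-select⁻ : ∀ {i} → i ∈ select P? → P i
  ∈-select⁻ {i} i∈ with P? i | trans (sym (lookup∘tabulate _ i)) ([]=⇒lookup i∈)
  ... | yes Pi | _ = Pi

  ∣select∣≡∑ : ∣ select P? ∣ ≡ ∑[ i < n ] 𝟙 (does (P? i))
  ∣select∣≡∑ = trans (∣p∣≡∑ (select P?)) (sum-cong-≗ (cong 𝟙 ∘ lookup∘tabulate (λ i → does (P? i))))

allSubsets : ∀ n → List (Subset n)
allSubsets zero    = [] ∷ []
allSubsets (suc n) = map (outside ∷_) (allSubsets n) ++ map (inside ∷_) (allSubsets n)

∈-allSubsets : (p : Subset n) → p ∈ˡ allSubsets n
∈-allSubsets []            = here refl
∈-allSubsets (outside ∷ p) = ∈-++⁺ˡ (∈-map⁺ (outside ∷_) (∈-allSubsets p))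
∈-allSubsets (inside  ∷ p) = ∈-++⁺ʳ _ (∈-map⁺ (inside ∷_) (∈-allSubsets p))

allSubsets-unique : ∀ n → Unique (allSubsets n)
allSubsets-unique zero    = [] ∷ []
allSubsets-unique (suc n) = Unique.++⁺ (cons⁺ outside) (cons⁺ inside) apart
  where
  cons⁺ : ∀ x → Unique (map (x ∷_) (allSubsets n))
  cons⁺ x = Unique.map⁺ ∷-injectiveʳ (allSubsets-unique n)
  apart : ∀ {p} → ¬ (p ∈ˡ map (outside ∷_) (allSubsets n) × p ∈ˡ map (inside ∷_) (allSubsets n))
  apart (p∈ , p∈′) with ∈-map⁻ (outside ∷_) p∈ | ∈-map⁻ (inside ∷_) p∈′
  ... | _ , _ , refl | _ , _ , ()

SubsetOfSize : ℕ → Subset n → Subset n → Set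
SubsetOfSize t A T = T ⊆ A × ∣ T ∣ ≡ t

subsetOfSize? : ∀ t (A T : Subset n) → Dec (SubsetOfSize t A T)
subsetOfSize? t A T = (T ⊆? A) ×-dec (∣ T ∣ ≟ t)

∑-subsetsOfSize≡C : (A : Subset n) (t : ℕ) → ∑[ T ∈ allSubsets n ] 𝟙 (does (subsetOfSize? t A T)) ≡ ∣ A ∣ C t
∑-subsetsOfSize≡C []      zero    = refl
∑-subsetsOfSize≡C []      (suc t) = refl
∑-subsetsOfSize≡C {suc n} (a ∷ A) t = begin
  ∑[ T ∈ allSubsets (suc n) ] f T
    ≡⟨ ∑ˡ-++ (map (outside ∷_) (allSubsets n)) _ f ⟩
  ∑[ T ∈ map (outside ∷_) (allSubsets n) ] f T + ∑[ T ∈ map (inside ∷_) (allSubsets n) ] f T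
    ≡⟨ cong₂ _+_ (∑ˡ-map (outside ∷_) (allSubsets n) f) (∑ˡ-map (inside ∷_) (allSubsets n) f) ⟩
  ∑[ T ∈ allSubsets n ] f (outside ∷ T) + ∑[ T ∈ allSubsets n ] f (inside ∷ T)
    ≡⟨ split a t ⟩
  ∣ a ∷ A ∣ C t ∎
  where
  open ≡-Reasoning
  f : Subset (suc n) → ℕ
  f T = 𝟙 (does (subsetOfSize? t (a ∷ A) T))
  split : ∀ a t → ∑[ T ∈ allSubsets n ] 𝟙 (does (subsetOfSize? t A T))
                  + ∑[ T ∈ allSubsets n ] 𝟙 (does (subsetOfSize? t (a ∷ A) (inside ∷ T)))
                ≡ ∣ a ∷ A ∣ C t
  split outside t =
    trans (cong₂ _+_ (∑-subsetsOfSize≡C A t) (∑ˡ-zero (allSubsets n) (λ _ → refl))) (+-identityʳ _)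
  split inside zero =
    cong₂ _+_ (∑-subsetsOfSize≡C A zero) (∑ˡ-zero (allSubsets n) (λ {T} _ → cong 𝟙 (∧-zeroʳ (does (T ⊆? A)))))
  split inside (suc t) = begin
    _                         ≡⟨ cong₂ _+_ (∑-subsetsOfSize≡C A (suc t)) (∑-subsetsOfSize≡C A t) ⟩
    ∣ A ∣ C suc t + ∣ A ∣ C t ≡⟨ +-comm (∣ A ∣ C suc t) (∣ A ∣ C t) ⟩
    ∣ A ∣ C t + ∣ A ∣ C suc t ≡⟨ nCk+nC[k+1]≡[n+1]C[k+1] ∣ A ∣ t ⟩
    suc ∣ A ∣ C suc t         ∎

∑-ofSize≡C : ∀ n t → ∑[ T ∈ allSubsets n ] 𝟙 (∣ T ∣ ≡ᵇ t) ≡ n C t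
∑-ofSize≡C n t = begin
  ∑[ T ∈ allSubsets n ] 𝟙 (∣ T ∣ ≡ᵇ t)                   ≡⟨ ∑ˡ-cong (allSubsets n) T⊆⊤ ⟨
  ∑[ T ∈ allSubsets n ] 𝟙 (does (subsetOfSize? t ⊤ T))  ≡⟨ ∑-subsetsOfSize≡C (⊤ {n}) t ⟩
  ∣ ⊤ {n} ∣ C t                                          ≡⟨ cong (_C t) (∣⊤∣≡n n) ⟩
  n C t                                                  ∎
  where
  open ≡-Reasoning
  T⊆⊤ : ∀ T → 𝟙 (does (subsetOfSize? t ⊤ T)) ≡ 𝟙 (∣ T ∣ ≡ᵇ t)
  T⊆⊤ T = cong (λ b → 𝟙 (b ∧ (∣ T ∣ ≡ᵇ t))) (dec-true (T ⊆? ⊤) (⊆-max T))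

grow : ∀ {P Q : Subset n} r → P ⊆ Q → ∣ P ∣ ≤ r →
       ∃ λ U → P ⊆ U × U ⊆ Q × ∣ U ∣ ≤ r × (∣ U ∣ ≡ r ⊎ Q ⊆ U)
grow {P = []} {[]} r _ _ = [] , ⊆-refl , ⊆-refl , z≤n , inj₂ ⊆-refl
grow {P = inside ∷ P} {outside ∷ Q} r P⊆Q _ with () ← P⊆Q here
grow {P = inside ∷ P} {inside ∷ Q} (suc r) P⊆Q (s≤s ∣P∣≤r)
  with U , P⊆U , U⊆Q , ∣U∣≤r , full ← grow r (drop-∷-⊆ P⊆Q) ∣P∣≤r
  = inside ∷ U , in⊆in P⊆U , in⊆in U⊆Q , s≤s ∣U∣≤r , Sum.map (cong suc) in⊆in full
grow {P = outside ∷ P} {outside ∷ Q} r P⊆Q ∣P∣≤r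
  with U , P⊆U , U⊆Q , ∣U∣≤r , full ← grow r (drop-∷-⊆ P⊆Q) ∣P∣≤r
  = outside ∷ U , s⊆s P⊆U , s⊆s U⊆Q , ∣U∣≤r , Sum.map₂ s⊆s full
grow {P = outside ∷ P} {inside ∷ Q} zero P⊆Q ∣P∣≤0 =
  outside ∷ P , ⊆-refl , out⊆ (drop-∷-⊆ P⊆Q) , ∣P∣≤0 , inj₁ (n≤0⇒n≡0 ∣P∣≤0)
grow {P = outside ∷ P} {inside ∷ Q} (suc r) P⊆Q ∣P∣≤1+r with ∣ P ∣ ≤? r
... | yes ∣P∣≤r
  with U , P⊆U , U⊆Q , ∣U∣≤r , full ← grow r (drop-∷-⊆ P⊆Q) ∣P∣≤r
  = inside ∷ U , out⊆ P⊆U , in⊆in U⊆Q , s≤s ∣U∣≤r , Sum.map (cong suc) in⊆in full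
... | no ∣P∣≰r
  with U , P⊆U , U⊆Q , ∣U∣≤1+r , _ ← grow (suc r) (drop-∷-⊆ P⊆Q) ∣P∣≤1+r
  = outside ∷ U , s⊆s P⊆U , out⊆ U⊆Q , ∣U∣≤1+r ,
    inj₁ (≤-antisym ∣U∣≤1+r (≤-trans (≰⇒> ∣P∣≰r) (p⊆q⇒∣p∣≤∣q∣ P⊆U)))

grow-to : ∀ {P Q : Subset n} {r} → P ⊆ Q → ∣ P ∣ ≤ r → r ≤ ∣ Q ∣ →
          ∃ λ U → P ⊆ U × U ⊆ Q × ∣ U ∣ ≡ r
grow-to {r = r} P⊆Q ∣P∣≤r r≤∣Q∣ with grow r P⊆Q ∣P∣≤r
... | U , P⊆U , U⊆Q , _      , inj₁ ∣U∣≡r = U , P⊆U , U⊆Q , ∣U∣≡r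
... | U , P⊆U , U⊆Q , ∣U∣≤r , inj₂ Q⊆U  =
  U , P⊆U , U⊆Q , ≤-antisym ∣U∣≤r (≤-trans r≤∣Q∣ (p⊆q⇒∣p∣≤∣q∣ Q⊆U))

-- T ∩ A as a subset of Fin ∣ A ∣, listing the points of A in increasing order.
restrict : (A : Subset n) → Subset n → Subset ∣ A ∣
restrict []            []      = []
restrict (inside  ∷ A) (x ∷ T) = x ∷ restrict A T
restrict (outside ∷ A) (_ ∷ T) = restrict A T

restrict-injective : ∀ {A T T′ : Subset n} → T ⊆ A → T′ ⊆ A → restrict A T ≡ restrict A T′ → T ≡ T′
restrict-injective {A = []} {[]} {[]} _ _ _ = refl
restrict-injective {A = inside ∷ A} {_ ∷ _} {_ ∷ _} T⊆A T′⊆A eq =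
  cong₂ _∷_ (∷-injectiveˡ eq) (restrict-injective (drop-∷-⊆ T⊆A) (drop-∷-⊆ T′⊆A) (∷-injectiveʳ eq))
restrict-injective {A = outside ∷ A} {outside ∷ _} {outside ∷ _} T⊆A T′⊆A eq =
  cong (outside ∷_) (restrict-injective (drop-∷-⊆ T⊆A) (drop-∷-⊆ T′⊆A) eq)
restrict-injective {A = outside ∷ A} {inside ∷ _} T⊆A _ _ with () ← T⊆A here
restrict-injective {A = outside ∷ A} {outside ∷ _} {inside ∷ _} _ T′⊆A _ with () ← T′⊆A here

∣restrict∣ : ∀ {A T : Subset n} → T ⊆ A → ∣ restrict A T ∣ ≡ ∣ T ∣
∣restrict∣ {A = []}          {[]}          _   = refl
∣restrict∣ {A = inside ∷ A}  {inside ∷ T}  T⊆A = cong suc (∣restrict∣ (drop-∷-⊆ T⊆A))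
∣restrict∣ {A = inside ∷ A}  {outside ∷ T} T⊆A = ∣restrict∣ (drop-∷-⊆ T⊆A)
∣restrict∣ {A = outside ∷ A} {outside ∷ T} T⊆A = ∣restrict∣ (drop-∷-⊆ T⊆A)
∣restrict∣ {A = outside ∷ A} {inside ∷ T}  T⊆A with () ← T⊆A here

restrict-lookup : ∀ {A : Subset n} {i} → i ∈ A → ∃ λ x → ∀ T → lookup (restrict A T) x ≡ lookup T i
restrict-lookup {A = inside ∷ A} here = zero , λ { (_ ∷ _) → refl }
restrict-lookup {A = inside ∷ A} (there i∈A) with x , eq ← restrict-lookup i∈A =
  suc x , λ { (_ ∷ T) → eq T }
restrict-lookup {A = outside ∷ A} (there i∈A) with x , eq ← restrict-lookup i∈A =
  x , λ { (_ ∷ T) → eq T }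

[]≔outside-⊆ : (T : Subset n) (i : Fin n) → T [ i ]≔ outside ⊆ T
[]≔outside-⊆ (_ ∷ T) zero    (there x∈) = there x∈
[]≔outside-⊆ (_ ∷ T) (suc i) here       = here
[]≔outside-⊆ (_ ∷ T) (suc i) (there x∈) = there ([]≔outside-⊆ T i x∈)

∣[]≔inside∣ : (S : Subset n) {i : Fin n} → i ∉ S → ∣ S [ i ]≔ inside ∣ ≡ suc ∣ S ∣
∣[]≔inside∣ (outside ∷ S) {zero}  _   = refl
∣[]≔inside∣ (inside  ∷ S) {zero}  i∉S = contradiction here i∉S
∣[]≔inside∣ (inside  ∷ S) {suc i} i∉S = cong suc (∣[]≔inside∣ S (λ i∈S → i∉S (there i∈S)))
∣[]≔inside∣ (outside ∷ S) {suc i} i∉S = ∣[]≔inside∣ S (λ i∈S → i∉S (there i∈S))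

[]≔inside-[]≔outside : (S : Subset n) {i : Fin n} → i ∉ S → S [ i ]≔ inside [ i ]≔ outside ≡ S
[]≔inside-[]≔outside S {i} i∉S = begin
  S [ i ]≔ inside [ i ]≔ outside ≡⟨ []≔-idempotent S i ⟩
  S [ i ]≔ outside               ≡⟨ cong (S [ i ]≔_) (¬-not (i∉S ∘ lookup⇒[]= i S)) ⟨
  S [ i ]≔ lookup S i            ≡⟨ []≔-lookup S i ⟩
  S                              ∎
  where open ≡-Reasoning

-- Incidence counts

count≡∑ : (i : Fin n) (U : Fin m → Subset n) → count i U ≡ ∑[ j < m ] 𝟙 (lookup (U j) i)
count≡∑ i U = trans (∣p∣≡∑ (tabulate (λ j → lookup (U j) i)))
                    (sum-cong-≗ (cong 𝟙 ∘ lookup∘tabulate (λ j → lookup (U j) i)))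

count-++ : (i : Fin n) (U : Fin l → Subset n) (V : Fin m → Subset n) →
           count i (U Vector.++ V) ≡ count i U + count i V
count-++ i U V = begin
  count i (U Vector.++ V)                                        ≡⟨ count≡∑ i (U Vector.++ V) ⟩
  ∑[ j < _ ] 𝟙 (lookup ((U Vector.++ V) j) i)                    ≡⟨ ∑-++ (λ X → 𝟙 (lookup X i)) U V ⟩
  ∑[ j < _ ] 𝟙 (lookup (U j) i) + ∑[ j < _ ] 𝟙 (lookup (V j) i)  ≡⟨ cong₂ _+_ (count≡∑ i U) (count≡∑ i V) ⟨
  count i U + count i V                                          ∎
  where open ≡-Reasoning

++-all : ∀ {A : Set} {P : A → Set} (U : Vector A l) (V : Vector A m) →
         (∀ j → P (U j)) → (∀ j → P (V j)) → ∀ j → P ((U Vector.++ V) j)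
++-all {l = l} U V PU PV j with splitAt l j
... | inj₁ j′ = PU j′
... | inj₂ j′ = PV j′

count-mono : ∀ {U V : Fin m → Subset n} → (∀ j → U j ⊆ V j) → ∀ i → count i U ≤ count i V
count-mono {U = U} {V} U⊆V i = begin
  count i U                     ≡⟨ count≡∑ i U ⟩
  ∑[ j < _ ] 𝟙 (lookup (U j) i) ≤⟨ ∑-mono-≤ (λ j → 𝟙-lookup-mono (U⊆V j) i) ⟩
  ∑[ j < _ ] 𝟙 (lookup (V j) i) ≡⟨ count≡∑ i V ⟨
  count i V                     ∎
  where open ≤-Reasoning

count-∉ : ∀ {U : Fin m → Subset n} {A i} → (∀ j → U j ⊆ A) → i ∉ A → count i U ≡ 0
count-∉ {m = m} {U = U} {A} {i} U⊆A i∉A =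
  trans (count≡∑ i U) (trans (sum-cong-≗ 𝟙≡0) (sum-replicate-zero m))
  where
  𝟙≡0 : ∀ j → 𝟙 (lookup (U j) i) ≡ 0
  𝟙≡0 j with lookup (U j) i in Uji≡
  ... | false = refl
  ... | true  = contradiction (U⊆A j (lookup⇒[]= i (U j) Uji≡)) i∉A

∑count≡∑∣∣ : (U : Fin m → Subset n) → ∑[ i < n ] count i U ≡ ∑[ j < m ] ∣ U j ∣
∑count≡∑∣∣ {m} {n} U = begin
  ∑[ i < n ] count i U                       ≡⟨ sum-cong-≗ (λ i → count≡∑ i U) ⟩
  ∑[ i < n ] ∑[ j < m ] 𝟙 (lookup (U j) i)   ≡⟨ ∑-comm (λ i j → 𝟙 (lookup (U j) i)) ⟩
  ∑[ j < m ] ∑[ i < n ] 𝟙 (lookup (U j) i)   ≡⟨ sum-cong-≗ (λ j → ∣p∣≡∑ (U j)) ⟨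
  ∑[ j < m ] ∣ U j ∣                         ∎
  where open ≡-Reasoning

count-restrict : ∀ {A : Subset n} {i} → i ∈ A →
                 ∃ λ x → (T : Fin m → Subset n) → count x (restrict A ∘ T) ≡ count i T
count-restrict i∈A with x , eq ← restrict-lookup i∈A = x , λ T → cong ∣_∣ (tabulate-cong (eq ∘ T))

Disjoint⇒count-bounds : ∀ {k λ′ k₁ k₂} {A : Fin λ′ → Subset k} → Disjoint k₁ k₂ A →
                        ∀ x → count x A < k₁ × λ′ < count x A + k₂
Disjoint⇒count-bounds {k} {λ′} {k₁} {k₂} {A} (noCommon , covering) x = count<k₁ , λ′<count+k₂
  where
  holders : Subset λ′
  holders = tabulate (λ j → lookup (A j) x)
  holds : ∀ {j} → j ∈ holders → x ∈ A j
  holds {j} j∈ = lookup⇒[]= x (A j) (trans (sym (lookup∘tabulate _ j)) ([]=⇒lookup j∈))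
  held : ∀ {j} → x ∈ A j → j ∈ holders
  held {j} x∈ = lookup⇒[]= j holders (trans (lookup∘tabulate _ j) ([]=⇒lookup x∈))
  ∣⊥∣≤ : ∀ r → ∣ ⊥ {λ′} ∣ ≤ r
  ∣⊥∣≤ r = ≤-trans (≤-reflexive (∣⊥∣≡0 λ′)) z≤n
  count<k₁ : count x A < k₁
  count<k₁ with k₁ ≤? count x A
  ... | no  k₁≰ = ≰⇒> k₁≰
  ... | yes k₁≤ with B , _ , B⊆ , ∣B∣≡k₁ ← grow-to {Q = holders} ⊥⊆ (∣⊥∣≤ k₁) k₁≤ =
    contradiction (λ j j∈B → holds (B⊆ j∈B)) (noCommon B ∣B∣≡k₁ x)
  λ′<count+k₂ : λ′ < count x A + k₂
  λ′<count+k₂ with k₂ ≤? ∣ ∁ holders ∣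
  ... | no  k₂≰ = begin-strict
    λ′                            ≤⟨ m≤n+m∸n λ′ (count x A) ⟩
    count x A + (λ′ ∸ count x A)  ≡⟨ cong (count x A +_) (∣∁p∣≡n∸∣p∣ holders) ⟨
    count x A + ∣ ∁ holders ∣     <⟨ +-monoʳ-< (count x A) (≰⇒> k₂≰) ⟩
    count x A + k₂                ∎
    where open ≤-Reasoning
  ... | yes k₂≤ with B , _ , B⊆ , ∣B∣≡k₂ ← grow-to {Q = ∁ holders} ⊥⊆ (∣⊥∣≤ k₂) k₂≤
                 with j , j∈B , x∈Aj ← covering B ∣B∣≡k₂ x =
    contradiction (held x∈Aj) (x∈∁p⇒x∉p (B⊆ j∈B))

Disjoint⇒cover-bounds : ∀ {λ′ m s} {A : Subset n} {T : Fin λ′ → Subset n} {X : Fin λ′ → Subset ∣ A ∣} →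
  s ≤ λ′ + m → (∀ j → X j ≡ restrict A (T j)) → Disjoint (s + 1) (λ′ + m ∸ s + 1) X →
  ∀ {i} → i ∈ A → count i T ≤ s × s ≤ count i T + m
Disjoint⇒cover-bounds {λ′ = λ′} {m} {s} {T = T} {X} s≤λ′+m X≡ disjoint {i} i∈A
  with x , count-x≡ ← count-restrict i∈A
  with few , many ← Disjoint⇒count-bounds disjoint x
  = ≤-pred (subst (_< suc s) count≡ (subst (count x X <_) (+-comm s 1) few)) ,
    enough (subst (λ a → λ′ < a + (λ′ + m ∸ s + 1)) count≡ many)
  where
  count≡ : count x X ≡ count i T
  count≡ = trans (cong ∣_∣ (tabulate-cong (λ j → cong (λ Y → lookup Y x) (X≡ j)))) (count-x≡ T)
  enough : ∀ {a} → λ′ < a + (λ′ + m ∸ s + 1) → s ≤ a + m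
  enough {a} λ′< = +-cancelʳ-≤ λ′ s (a + m) (begin
    s + λ′                  ≤⟨ +-monoʳ-≤ s (≤-pred (subst (λ′ <_) a+[x+1]≡1+[a+x] λ′<)) ⟩
    s + (a + (λ′ + m ∸ s))  ≡⟨ x∙yz≈y∙xz s a _ ⟩
    a + (s + (λ′ + m ∸ s))  ≡⟨ cong (a +_) (m+[n∸m]≡n s≤λ′+m) ⟩
    a + (λ′ + m)            ≡⟨ x∙yz≈xz∙y a λ′ m ⟩
    a + m + λ′              ∎)
    where
    open ≤-Reasoning
    a+[x+1]≡1+[a+x] : a + (λ′ + m ∸ s + 1) ≡ suc (a + (λ′ + m ∸ s))
    a+[x+1]≡1+[a+x] = trans (cong (a +_) (+-comm _ 1)) (+-suc a _)

-- Covering a demand by layers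

atLeast : ℕ → (Fin n → ℕ) → Subset n
atLeast c d = select (λ i → c ≤? d i)

∣atLeast∣*c≤∑ : ∀ c (d : Fin n → ℕ) → ∣ atLeast c d ∣ * c ≤ ∑[ i < n ] d i
∣atLeast∣*c≤∑ {n} c d = begin
  ∣ atLeast c d ∣ * c                      ≡⟨ cong (_* c) (∣select∣≡∑ (λ i → c ≤? d i)) ⟩
  ∑[ i < n ] 𝟙 (does (c ≤? d i)) * c       ≡⟨ *-distribʳ-sum c (λ i → 𝟙 (does (c ≤? d i))) ⟩
  ∑[ i < n ] (𝟙 (does (c ≤? d i)) * c)     ≤⟨ ∑-mono-≤ term≤ ⟩
  ∑[ i < n ] d i                           ∎
  where
  open ≤-Reasoning
  term≤ : ∀ i → 𝟙 (does (c ≤? d i)) * c ≤ d i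
  term≤ i with c ≤? d i
  ... | yes c≤d = ≤-trans (≤-reflexive (cong (λ b → 𝟙 b * c) (dec-true (c ≤? d i) c≤d)))
                          (≤-trans (≤-reflexive (+-identityʳ c)) c≤d)
  ... | no  c≰d = ≤-trans (≤-reflexive (cong (λ b → 𝟙 b * c) (dec-false (c ≤? d i) c≰d))) z≤n

-- The layer contains every point of demand 1 + m (at most r of them by the previous lemma) and
-- is topped up with other points of positive demand until it has r points or runs out of them.
peelLayer : ∀ m r (d : Fin n → ℕ) → (∀ i → d i ≤ suc m) → ∑[ i < n ] d i ≤ suc m * r →
            ∃ λ U₀ → ∣ U₀ ∣ ≤ r × U₀ ⊆ atLeast 1 d ×
                     (∀ i → d i ∸ 𝟙 (lookup U₀ i) ≤ m) × ∑[ i < n ] (d i ∸ 𝟙 (lookup U₀ i)) ≤ m * r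
peelLayer {n} m r d d≤1+m ∑d≤ with grow r full⊆positive ∣full∣≤r
  where
  full⊆positive : atLeast (suc m) d ⊆ atLeast 1 d
  full⊆positive i∈ = ∈-select⁺ (λ i → 1 ≤? d i) (≤-trans (s≤s z≤n) (∈-select⁻ (λ i → suc m ≤? d i) i∈))
  ∣full∣≤r : ∣ atLeast (suc m) d ∣ ≤ r
  ∣full∣≤r = *-cancelʳ-≤ _ r (suc m)
    (≤-trans (∣atLeast∣*c≤∑ (suc m) d) (≤-trans ∑d≤ (≤-reflexive (*-comm (suc m) r))))
... | U₀ , full⊆U₀ , U₀⊆positive , ∣U₀∣≤r , filled =
  U₀ , ∣U₀∣≤r , U₀⊆positive , rest≤m , [ ∑rest≤-if-size-r , ∑rest≤-if-exhaustive ]′ filled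
  where
  positive : Subset n
  positive = atLeast 1 d

  rest : Fin n → ℕ
  rest i = d i ∸ 𝟙 (lookup U₀ i)

  rest≤m : ∀ i → rest i ≤ m
  rest≤m i with lookup U₀ i in U₀i≡
  ... | true  = ∸-monoˡ-≤ 1 (d≤1+m i)
  ... | false with suc m ≤? d i
  ...   | no  d≱1+m = ≤-pred (≰⇒> d≱1+m)
  ...   | yes d≥1+m with () ← trans (sym U₀i≡) ([]=⇒lookup (full⊆U₀ (∈-select⁺ (λ i → suc m ≤? d i) d≥1+m)))

  rest+𝟙≡d : ∀ i → rest i + 𝟙 (lookup U₀ i) ≡ d i
  rest+𝟙≡d i with lookup U₀ i in U₀i≡
  ... | true  = m∸n+n≡m (∈-select⁻ (λ i → 1 ≤? d i) (U₀⊆positive (lookup⇒[]= i U₀ U₀i≡)))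
  ... | false = +-identityʳ (d i)

  ∑rest+∣U₀∣≡∑d : ∑[ i < n ] rest i + ∣ U₀ ∣ ≡ ∑[ i < n ] d i
  ∑rest+∣U₀∣≡∑d = begin
    ∑[ i < n ] rest i + ∣ U₀ ∣                      ≡⟨ cong (∑[ i < n ] rest i +_) (∣p∣≡∑ U₀) ⟩
    ∑[ i < n ] rest i + ∑[ i < n ] 𝟙 (lookup U₀ i)  ≡⟨ ∑-distrib-+ rest _ ⟨
    ∑[ i < n ] (rest i + 𝟙 (lookup U₀ i))           ≡⟨ sum-cong-≗ rest+𝟙≡d ⟩
    ∑[ i < n ] d i                                  ∎
    where open ≡-Reasoning

  ∑rest≤-if-size-r : ∣ U₀ ∣ ≡ r → ∑[ i < n ] rest i ≤ m * r
  ∑rest≤-if-size-r ∣U₀∣≡r = +-cancelʳ-≤ r _ (m * r) (begin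
    ∑[ i < n ] rest i + r      ≡⟨ cong (∑[ i < n ] rest i +_) ∣U₀∣≡r ⟨
    ∑[ i < n ] rest i + ∣ U₀ ∣ ≡⟨ ∑rest+∣U₀∣≡∑d ⟩
    ∑[ i < n ] d i             ≤⟨ ∑d≤ ⟩
    r + m * r                  ≡⟨ +-comm r (m * r) ⟩
    m * r + r                  ∎)
    where open ≤-Reasoning

  rest≤𝟙*m : positive ⊆ U₀ → ∀ i → rest i ≤ 𝟙 (lookup U₀ i) * m
  rest≤𝟙*m positive⊆U₀ i with lookup U₀ i in U₀i≡
  ... | true  = ≤-trans (∸-monoˡ-≤ 1 (d≤1+m i)) (≤-reflexive (sym (+-identityʳ m)))
  ... | false with 1 ≤? d i
  ...   | no  d≱1 = ≤-reflexive (n≤0⇒n≡0 (≤-pred (≰⇒> d≱1)))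
  ...   | yes d≥1 with () ← trans (sym U₀i≡) ([]=⇒lookup (positive⊆U₀ (∈-select⁺ (λ i → 1 ≤? d i) d≥1)))

  ∑rest≤-if-exhaustive : positive ⊆ U₀ → ∑[ i < n ] rest i ≤ m * r
  ∑rest≤-if-exhaustive positive⊆U₀ = begin
    ∑[ i < n ] rest i                 ≤⟨ ∑-mono-≤ (rest≤𝟙*m positive⊆U₀) ⟩
    ∑[ i < n ] (𝟙 (lookup U₀ i) * m)  ≡⟨ *-distribʳ-sum m (λ i → 𝟙 (lookup U₀ i)) ⟨
    ∑[ i < n ] 𝟙 (lookup U₀ i) * m    ≡⟨ cong (_* m) (∣p∣≡∑ U₀) ⟨
    ∣ U₀ ∣ * m                        ≤⟨ *-monoˡ-≤ m ∣U₀∣≤r ⟩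
    r * m                             ≡⟨ *-comm r m ⟩
    m * r                             ∎
    where open ≤-Reasoning

cover : ∀ m r (d : Fin n → ℕ) → (∀ i → d i ≤ m) → ∑[ i < n ] d i ≤ m * r →
        ∃ λ (U : Fin m → Subset n) →
          (∀ j → ∣ U j ∣ ≤ r) × (∀ j → U j ⊆ atLeast 1 d) × (∀ i → d i ≤ count i U)
cover zero    r d d≤0 _ = (λ ()) , (λ ()) , (λ ()) , d≤0
cover (suc m) r d d≤1+m ∑d≤
  with U₀ , ∣U₀∣≤r , U₀⊆positive , rest≤m , ∑rest≤ ← peelLayer m r d d≤1+m ∑d≤
  with U , ∣U∣≤r , U⊆positive , covered ← cover m r (λ i → d i ∸ 𝟙 (lookup U₀ i)) rest≤m ∑rest≤
  = (U₀ Vector.∷ U) , sizes , layers⊆positive , coveredAll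
  where
  sizes : ∀ j → ∣ (U₀ Vector.∷ U) j ∣ ≤ r
  sizes zero    = ∣U₀∣≤r
  sizes (suc j) = ∣U∣≤r j
  layers⊆positive : ∀ j → (U₀ Vector.∷ U) j ⊆ atLeast 1 d
  layers⊆positive zero    = U₀⊆positive
  layers⊆positive (suc j) {i} i∈ =
    ∈-select⁺ (λ i → 1 ≤? d i)
      (≤-trans (∈-select⁻ (λ i → 1 ≤? d i ∸ 𝟙 (lookup U₀ i)) (U⊆positive j i∈)) (m∸n≤m (d i) (𝟙 (lookup U₀ i))))
  coveredAll : ∀ i → d i ≤ count i (U₀ Vector.∷ U)
  coveredAll i = begin
    d i                                        ≤⟨ m≤n+m∸n (d i) (𝟙 (lookup U₀ i)) ⟩
    𝟙 (lookup U₀ i) + (d i ∸ 𝟙 (lookup U₀ i))  ≤⟨ +-monoʳ-≤ _ (covered i) ⟩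
    𝟙 (lookup U₀ i) + count i U                ≡⟨ ∣x∷p∣ (lookup U₀ i) (tabulate (λ j → lookup (U j) i)) ⟨
    count i (U₀ Vector.∷ U)                    ∎
    where open ≤-Reasoning

-- Outside A the deficit is 0; on A it is s ∸ count i T ≤ m, and the deficits sum to
-- s ∣ A ∣ - λ′ (1 + t′) = m t′, so `cover` spreads them over m sets of size at most t′.
module _ {λ′ m t′ s} {A : Subset n} (T : Fin λ′ → Subset n)
         (T⊆A : ∀ j → T j ⊆ A) (∣T∣≡1+t′ : ∀ j → ∣ T j ∣ ≡ suc t′)
         (s*∣A∣≡ : s * ∣ A ∣ ≡ t′ * (λ′ + m) + λ′)
         (bounds : ∀ {i} → i ∈ A → count i T ≤ s × s ≤ count i T + m) where

  private
    deficit : Fin n → ℕ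
    deficit i = 𝟙 (lookup A i) * s ∸ count i T

    deficit-∈ : ∀ {i} → i ∈ A → deficit i ≡ s ∸ count i T
    deficit-∈ {i} i∈A =
      trans (cong (λ b → 𝟙 b * s ∸ count i T) ([]=⇒lookup i∈A)) (cong (_∸ count i T) (*-identityˡ s))

    deficit-∉ : ∀ {i} → i ∉ A → deficit i ≡ 0
    deficit-∉ {i} i∉A =
      trans (cong (λ b → 𝟙 b * s ∸ count i T) (¬-not (i∉A ∘ lookup⇒[]= i A))) (0∸n≡0 (count i T))

    count≤ : ∀ i → count i T ≤ 𝟙 (lookup A i) * s
    count≤ i with lookup A i in Ai≡
    ... | true  = ≤-trans (proj₁ (bounds (lookup⇒[]= i A Ai≡))) (≤-reflexive (sym (+-identityʳ s)))
    ... | false = ≤-reflexive (count-∉ T⊆A (λ i∈A → contradiction (trans (sym Ai≡) ([]=⇒lookup i∈A)) λ ()))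

    deficit≤m : ∀ i → deficit i ≤ m
    deficit≤m i with i ∈? A
    ... | yes i∈A = ≤-trans (≤-reflexive (deficit-∈ i∈A)) (m≤n+o⇒m∸n≤o s (count i T) (proj₂ (bounds i∈A)))
    ... | no  i∉A = ≤-trans (≤-reflexive (deficit-∉ i∉A)) z≤n

    ∑deficit+λ′[1+t′]≡ : ∑[ i < n ] deficit i + λ′ * suc t′ ≡ ∣ A ∣ * s
    ∑deficit+λ′[1+t′]≡ = begin
      ∑[ i < n ] deficit i + λ′ * suc t′           ≡⟨ cong (∑[ i < n ] deficit i +_) λ′[1+t′]≡∑count ⟩
      ∑[ i < n ] deficit i + ∑[ i < n ] count i T  ≡⟨ ∑-distrib-+ deficit (λ i → count i T) ⟨
      ∑[ i < n ] (deficit i + count i T)           ≡⟨ sum-cong-≗ (λ i → m∸n+n≡m (count≤ i)) ⟩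
      ∑[ i < n ] (𝟙 (lookup A i) * s)              ≡⟨ *-distribʳ-sum s (λ i → 𝟙 (lookup A i)) ⟨
      ∑[ i < n ] 𝟙 (lookup A i) * s                ≡⟨ cong (_* s) (∣p∣≡∑ A) ⟨
      ∣ A ∣ * s                                    ∎
      where
      open ≡-Reasoning
      λ′[1+t′]≡∑count : λ′ * suc t′ ≡ ∑[ i < n ] count i T
      λ′[1+t′]≡∑count = sym (trans (∑count≡∑∣∣ T) (trans (sum-cong-≗ ∣T∣≡1+t′) (∑-const λ′ (suc t′))))

    ∑deficit≡ : ∑[ i < n ] deficit i ≡ m * t′
    ∑deficit≡ = +-cancelʳ-≡ (λ′ * suc t′) _ _ (begin
      ∑[ i < n ] deficit i + λ′ * suc t′  ≡⟨ ∑deficit+λ′[1+t′]≡ ⟩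
      ∣ A ∣ * s                           ≡⟨ *-comm ∣ A ∣ s ⟩
      s * ∣ A ∣                           ≡⟨ s*∣A∣≡ ⟩
      t′ * (λ′ + m) + λ′                  ≡⟨ regroup t′ λ′ m ⟩
      m * t′ + λ′ * suc t′                ∎)
      where
      open ≡-Reasoning
      regroup : ∀ t′ λ′ m → t′ * (λ′ + m) + λ′ ≡ m * t′ + λ′ * suc t′
      regroup = solve-∀

  complete-cover : t′ ≤ ∣ A ∣ →
    ∃ λ (U : Fin m → Subset n) →
      (∀ j → U j ⊆ A) × (∀ j → ∣ U j ∣ ≡ t′) × (∀ {i} → i ∈ A → s ≤ count i T + count i U)
  complete-cover t′≤∣A∣
    with U₀ , ∣U₀∣≤t′ , U₀⊆positive , deficit≤count ← cover m t′ deficit deficit≤m (≤-reflexive ∑deficit≡)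
    = U , U⊆A , ∣U∣≡t′ , covered
    where
    U₀⊆A : ∀ j → U₀ j ⊆ A
    U₀⊆A j {i} i∈U₀ with i ∈? A
    ... | yes i∈A = i∈A
    ... | no  i∉A = contradiction (subst (1 ≤_) (deficit-∉ i∉A)
                                     (∈-select⁻ (λ i → 1 ≤? deficit i) (U₀⊆positive j i∈U₀))) λ ()

    grown : ∀ j → ∃ λ S → U₀ j ⊆ S × S ⊆ A × ∣ S ∣ ≡ t′
    grown j = grow-to (U₀⊆A j) (∣U₀∣≤t′ j) t′≤∣A∣

    U : Fin m → Subset n
    U j = proj₁ (grown j)

    U⊆A : ∀ j → U j ⊆ A
    U⊆A j = proj₁ (proj₂ (proj₂ (grown j)))

    ∣U∣≡t′ : ∀ j → ∣ U j ∣ ≡ t′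
    ∣U∣≡t′ j = proj₂ (proj₂ (proj₂ (grown j)))

    covered : ∀ {i} → i ∈ A → s ≤ count i T + count i U
    covered {i} i∈A = begin
      s                            ≤⟨ m≤n+m∸n s (count i T) ⟩
      count i T + (s ∸ count i T)  ≡⟨ cong (count i T +_) (deficit-∈ i∈A) ⟨
      count i T + deficit i        ≤⟨ +-monoʳ-≤ (count i T) (deficit≤count i) ⟩
      count i T + count i U₀       ≤⟨ +-monoʳ-≤ (count i T) (count-mono (λ j → proj₁ (proj₂ (grown j))) i) ⟩
      count i T + count i U        ∎
      where open ≤-Reasoning

-- Ownership in a frameproof family

_≟ˢ_ : (p q : Subset n) → Dec (p ≡ q)
_≟ˢ_ = ≡-dec Bool._≟_

module Ownership {n k : ℕ} (F : Family n k) where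

  Owns : Subset n → Subset n → Set
  Owns A X = X ⊆ A × (∀ {B} → B ∈ˡ sets F → X ⊆ B → B ≡ A)

  owns? : ∀ A X → Dec (Owns A X)
  owns? A X = (X ⊆? A) ×-dec map′ All.lookup All.tabulate (all? (λ B → (X ⊆? B) →-dec (B ≟ˢ A)) (sets F))

  owner-unique : ∀ {A A′ X Y} → Owns A X → Owns A′ Y → A′ ∈ˡ sets F → X ⊆ Y → A′ ≡ A
  owner-unique (_ , onlyA) (Y⊆A′ , _) A′∈F X⊆Y = onlyA A′∈F (⊆-trans X⊆Y Y⊆A′)

  ¬Owns⇒shared : ∀ {A X} → X ⊆ A → ¬ Owns A X → ∃ λ B → B ∈ˡ sets F × X ⊆ B × B ≢ A
  ¬Owns⇒shared {A} {X} X⊆A ¬owns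
    with B , B∈F , ¬[X⊆B⇒B≡A] ← find (All.¬All⇒Any¬ (λ B → (X ⊆? B) →-dec (B ≟ˢ A)) (sets F)
                                                     (λ onlyA → ¬owns (X⊆A , All.lookup onlyA)))
    with X ⊆? B
  ... | yes X⊆B = B , B∈F , X⊆B , λ B≡A → ¬[X⊆B⇒B≡A] (λ _ → B≡A)
  ... | no  X⊈B = contradiction (λ X⊆B → contradiction X⊆B X⊈B) ¬[X⊆B⇒B≡A]

  ¬Owns⇒sharers : ∀ {A} {X : Fin l → Subset n} → (∀ j → X j ⊆ A) → (∀ j → ¬ Owns A (X j)) →
    ∃ λ (B : Fin l → Subset n) → (∀ j → B j ∈ˡ sets F) × (∀ j → X j ⊆ B j) × (∀ j → A ≢ B j)
  ¬Owns⇒sharers X⊆A ¬owns =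
    (λ j → proj₁ (sharer j)) , (λ j → proj₁ (proj₂ (sharer j))) ,
    (λ j → proj₁ (proj₂ (proj₂ (sharer j)))) , (λ j → proj₂ (proj₂ (proj₂ (sharer j))) ∘ sym)
    where sharer = λ j → ¬Owns⇒shared (X⊆A j) (¬owns j)

  frameproof-violation : ∀ {λ′ m s A} → Frameproof (λ′ + m) s F → A ∈ˡ sets F →
    (T : Fin λ′ → Subset n) (U : Fin m → Subset n) →
    (∀ j → T j ⊆ A) → (∀ j → ¬ Owns A (T j)) → (∀ j → U j ⊆ A) → (∀ j → ¬ Owns A (U j)) →
    ¬ (∀ {i} → i ∈ A → s ≤ count i T + count i U)
  frameproof-violation {s = s} {A} FP A∈F T U T⊆A ¬ownsT U⊆A ¬ownsU covers
    with B , B∈F , T⊆B , A≢B ← ¬Owns⇒sharers T⊆A ¬ownsT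
    with B′ , B′∈F , U⊆B′ , A≢B′ ← ¬Owns⇒sharers U⊆A ¬ownsU
    with i , i∈A , count<s ← FP A (B Vector.++ B′) A∈F (++-all {P = _∈ˡ sets F} B B′ B∈F B′∈F)
                                                       (++-all {P = A ≢_} B B′ A≢B A≢B′)
    = <⇒≱ count<s (begin
      s                          ≤⟨ covers i∈A ⟩
      count i T + count i U      ≤⟨ +-mono-≤ (count-mono T⊆B i) (count-mono U⊆B′ i) ⟩
      count i B + count i B′     ≡⟨ count-++ i B B′ ⟨
      count i (B Vector.++ B′)   ∎)
    where open ≤-Reasoning

-- Double counting claims

module Claiming {n k : ℕ} (F : Family n k) where
  open Ownership F

  Claims : ℕ → Subset n → Subset n → Fin n → Set
  Claims t A T i = ∣ T ∣ ≡ t × i ∈ T × (Owns A T ⊎ Owns A (T [ i ]≔ outside))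

  claims? : ∀ t A T i → Dec (Claims t A T i)
  claims? t A T i = (∣ T ∣ ≟ t) ×-dec (i ∈? T) ×-dec (owns? A T ⊎-dec owns? A (T [ i ]≔ outside))

  claim : ℕ → Subset n → Subset n → Fin n → ℕ
  claim t A T i = 𝟙 (does (claims? t A T i))

  claimed : ℕ → Subset n → ℕ
  claimed t A = ∑[ T ∈ allSubsets n ] ∑[ i < n ] claim t A T i

  claimant-unique : ∀ {t A A′ T i} → A ∈ˡ sets F → A′ ∈ˡ sets F → Claims t A T i → Claims t A′ T i → A ≡ A′
  claimant-unique {T = T} {i} A∈F A′∈F (_ , _ , ownsA) (_ , _ , ownsA′) with ownsA | ownsA′
  ... | inj₁ o | inj₁ o′ = sym (owner-unique o o′ A′∈F ⊆-refl)
  ... | inj₁ o | inj₂ o′ = owner-unique o′ o A∈F ([]≔outside-⊆ T i)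
  ... | inj₂ o | inj₁ o′ = sym (owner-unique o o′ A′∈F ([]≔outside-⊆ T i))
  ... | inj₂ o | inj₂ o′ = sym (owner-unique o o′ A′∈F ⊆-refl)

  claimants≤ : ∀ t T i → ∑[ A ∈ sets F ] claim t A T i ≤ 𝟙 (lookup T i)
  claimants≤ t T i with lookup T i in Ti≡
  ... | true  = ∑ˡ-𝟙≤1 (λ A → claims? t A T i) (unique F) claimant-unique
  ... | false = ≤-reflexive (∑ˡ-zero (sets F) (λ {A} _ → cong 𝟙 (dec-false (claims? t A T i) i∉T)))
    where
    i∉T : ∀ {A} → ¬ Claims t A T i
    i∉T (_ , i∈T , _) = contradiction (trans (sym Ti≡) ([]=⇒lookup i∈T)) λ ()

  claimsOn≤ : ∀ t T → ∑[ i < n ] ∑[ A ∈ sets F ] claim t A T i ≤ 𝟙 (∣ T ∣ ≡ᵇ t) * t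
  claimsOn≤ t T = bound (∣ T ∣ ≟ t)
    where
    bound : (∣T∣≟t : Dec (∣ T ∣ ≡ t)) → ∑[ i < n ] ∑[ A ∈ sets F ] claim t A T i ≤ 𝟙 (does ∣T∣≟t) * t
    bound (yes ∣T∣≡t) = begin
      ∑[ i < n ] ∑[ A ∈ sets F ] claim t A T i  ≤⟨ ∑-mono-≤ (claimants≤ t T) ⟩
      ∑[ i < n ] 𝟙 (lookup T i)                 ≡⟨ ∣p∣≡∑ T ⟨
      ∣ T ∣                                     ≡⟨ ∣T∣≡t ⟩
      t                                         ≡⟨ +-identityʳ t ⟨
      t + 0                                     ∎
      where open ≤-Reasoning
    bound (no ∣T∣≢t) = ≤-reflexive (trans (sum-cong-≗ noClaims) (sum-replicate-zero n))
      where
      noClaims : ∀ i → ∑[ A ∈ sets F ] claim t A T i ≡ 0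
      noClaims i = ∑ˡ-zero (sets F) (λ {A} _ → cong 𝟙 (dec-false (claims? t A T i) (∣T∣≢t ∘ proj₁)))

  ∑claimed≤nCt*t : ∀ t → ∑[ A ∈ sets F ] claimed t A ≤ (n C t) * t
  ∑claimed≤nCt*t t = begin
    ∑[ A ∈ sets F ] ∑[ T ∈ allSubsets n ] ∑[ i < n ] claim t A T i
      ≡⟨ ∑ˡ-comm (sets F) (allSubsets n) (λ A T → ∑[ i < n ] claim t A T i) ⟩
    ∑[ T ∈ allSubsets n ] ∑[ A ∈ sets F ] ∑[ i < n ] claim t A T i
      ≡⟨ ∑ˡ-cong (allSubsets n) (λ T → ∑ˡ-∑-comm (sets F) (λ A i → claim t A T i)) ⟩
    ∑[ T ∈ allSubsets n ] ∑[ i < n ] ∑[ A ∈ sets F ] claim t A T i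
      ≤⟨ ∑ˡ-mono-≤ (allSubsets n) (λ {T} _ → claimsOn≤ t T) ⟩
    ∑[ T ∈ allSubsets n ] (𝟙 (∣ T ∣ ≡ᵇ t) * t)
      ≡⟨ *-distribʳ-∑ˡ (allSubsets n) (λ T → 𝟙 (∣ T ∣ ≡ᵇ t)) t ⟨
    ∑[ T ∈ allSubsets n ] 𝟙 (∣ T ∣ ≡ᵇ t) * t
      ≡⟨ cong (_* t) (∑-ofSize≡C n t) ⟩
    (n C t) * t ∎
    where open ≤-Reasoning

  Owns⇒n∸t′≤claimed : ∀ {t′ A S} → Owns A S → ∣ S ∣ ≡ t′ → n ∸ t′ ≤ claimed (suc t′) A
  Owns⇒n∸t′≤claimed {t′} {A} {S} ownsS ∣S∣≡t′ = begin
    n ∸ t′                                                 ≡⟨ cong (n ∸_) ∣S∣≡t′ ⟨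
    n ∸ ∣ S ∣                                              ≡⟨ ∣∁p∣≡n∸∣p∣ S ⟨
    ∣ ∁ S ∣                                                ≡⟨ ∣p∣≡∑ (∁ S) ⟩
    ∑[ i < n ] 𝟙 (lookup (∁ S) i)                          ≤⟨ ∑-mono-≤ extensions ⟩
    ∑[ i < n ] ∑[ T ∈ allSubsets n ] claim (suc t′) A T i  ≡⟨ ∑ˡ-∑-comm (allSubsets n) (claim (suc t′) A) ⟨
    claimed (suc t′) A                                     ∎
    where
    open ≤-Reasoning
    extensions : ∀ i → 𝟙 (lookup (∁ S) i) ≤ ∑[ T ∈ allSubsets n ] claim (suc t′) A T i
    extensions i with lookup (∁ S) i in ∁Si≡
    ... | false = z≤n
    ... | true  = ≤-trans (≤-reflexive (cong 𝟙 (sym (dec-true (claims? (suc t′) A (S [ i ]≔ inside) i)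
                                                                 extension))))
                          (∈⇒≤∑ˡ (λ T → claim (suc t′) A T i) (∈-allSubsets (S [ i ]≔ inside)))
      where
      i∉S : i ∉ S
      i∉S = x∈∁p⇒x∉p (lookup⇒[]= i (∁ S) ∁Si≡)
      extension : Claims (suc t′) A (S [ i ]≔ inside) i
      extension = trans (∣[]≔inside∣ S i∉S) (cong suc ∣S∣≡t′) , []≔-updates S i ,
                  inj₂ (subst (Owns A) (sym ([]≔inside-[]≔outside S i∉S)) ownsS)

  OwnedOfSize NonOwnedOfSize : ℕ → Subset n → Subset n → Set
  OwnedOfSize    t A T = SubsetOfSize t A T × Owns A T
  NonOwnedOfSize t A T = SubsetOfSize t A T × ¬ Owns A T

  ownedOfSize? : ∀ t A T → Dec (OwnedOfSize t A T)
  ownedOfSize? t A T = subsetOfSize? t A T ×-dec owns? A T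

  nonOwnedOfSize? : ∀ t A T → Dec (NonOwnedOfSize t A T)
  nonOwnedOfSize? t A T = subsetOfSize? t A T ×-dec ¬? (owns? A T)

  #owned #nonOwned : ℕ → Subset n → ℕ
  #owned    t A = ∑[ T ∈ allSubsets n ] 𝟙 (does (ownedOfSize? t A T))
  #nonOwned t A = ∑[ T ∈ allSubsets n ] 𝟙 (does (nonOwnedOfSize? t A T))

  #owned+#nonOwned≡C : ∀ t A → #owned t A + #nonOwned t A ≡ ∣ A ∣ C t
  #owned+#nonOwned≡C t A = begin
    #owned t A + #nonOwned t A
      ≡⟨ ∑ˡ-distrib-+ (allSubsets n) (λ T → 𝟙 (does (ownedOfSize? t A T)))
                                     (λ T → 𝟙 (does (nonOwnedOfSize? t A T))) ⟨
    ∑[ T ∈ allSubsets n ] (𝟙 (does (ownedOfSize? t A T)) + 𝟙 (does (nonOwnedOfSize? t A T)))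
      ≡⟨ ∑ˡ-cong (allSubsets n) (λ T → 𝟙-∧-split (does (subsetOfSize? t A T)) (does (owns? A T))) ⟩
    ∑[ T ∈ allSubsets n ] 𝟙 (does (subsetOfSize? t A T))
      ≡⟨ ∑-subsetsOfSize≡C A t ⟩
    ∣ A ∣ C t ∎
    where open ≡-Reasoning

  #owned*t≤claimed : ∀ t A → #owned t A * t ≤ claimed t A
  #owned*t≤claimed t A = begin
    #owned t A * t
      ≡⟨ *-distribʳ-∑ˡ (allSubsets n) (λ T → 𝟙 (does (ownedOfSize? t A T))) t ⟩
    ∑[ T ∈ allSubsets n ] (𝟙 (does (ownedOfSize? t A T)) * t)
      ≤⟨ ∑ˡ-mono-≤ (allSubsets n) (λ {T} _ → owned*t≤ T (ownedOfSize? t A T)) ⟩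
    claimed t A ∎
    where
    open ≤-Reasoning
    owned*t≤ : ∀ T (owned? : Dec (OwnedOfSize t A T)) → 𝟙 (does owned?) * t ≤ ∑[ i < n ] claim t A T i
    owned*t≤ T (no _) = z≤n
    owned*t≤ T (yes ((_ , ∣T∣≡t) , ownsT)) = begin
      t + 0                       ≡⟨ +-identityʳ t ⟩
      t                           ≡⟨ ∣T∣≡t ⟨
      ∣ T ∣                       ≡⟨ ∣p∣≡∑ T ⟩
      ∑[ i < n ] 𝟙 (lookup T i)   ≤⟨ ∑-mono-≤ claimedAt ⟩
      ∑[ i < n ] claim t A T i    ∎
      where
      claimedAt : ∀ i → 𝟙 (lookup T i) ≤ claim t A T i
      claimedAt i with lookup T i in Ti≡
      ... | false = z≤n
      ... | true  = ≤-reflexive (cong 𝟙 (sym (dec-true (claims? t A T i)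
                                                         (∣T∣≡t , lookup⇒[]= i T Ti≡ , inj₁ ownsT))))

  nonOwnedFamily : ∀ t (A : Subset n) → Family ∣ A ∣ t
  nonOwnedFamily t A = family (map (restrict A) nonOwned) distinct sized
    where
    nonOwned : List (Subset n)
    nonOwned = filter (nonOwnedOfSize? t A) (allSubsets n)
    props : ∀ {T} → T ∈ˡ nonOwned → NonOwnedOfSize t A T
    props = proj₂ ∘ ∈-filter⁻ (nonOwnedOfSize? t A) {xs = allSubsets n}
    distinct : Unique (map (restrict A) nonOwned)
    distinct = map⁺-injectiveOn restrict-injective (All.tabulate (proj₁ ∘ proj₁ ∘ props))
                                (Unique.filter⁺ (nonOwnedOfSize? t A) (allSubsets-unique n))
    sized : All (λ X → ∣ X ∣ ≡ t) (map (restrict A) nonOwned)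
    sized = All.map⁺ (All.tabulate λ T∈ → let (T⊆A , ∣T∣≡t) , _ = props T∈ in trans (∣restrict∣ T⊆A) ∣T∣≡t)

  ∣nonOwnedFamily∣ : ∀ t A → length (sets (nonOwnedFamily t A)) ≡ #nonOwned t A
  ∣nonOwnedFamily∣ t A = trans (length-map (restrict A) (filter (nonOwnedOfSize? t A) (allSubsets n)))
                               (length-filter≡∑𝟙 (nonOwnedOfSize? t A) (allSubsets n))

  nonOwnedFamily-members : ∀ {t A λ′} (X : Fin λ′ → Subset ∣ A ∣) → (∀ j → X j ∈ˡ sets (nonOwnedFamily t A)) →
    ∃ λ (T : Fin λ′ → Subset n) → (∀ j → NonOwnedOfSize t A (T j)) × (∀ j → X j ≡ restrict A (T j))
  nonOwnedFamily-members {t} {A} X X∈G =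
    (λ j → proj₁ (preimage j)) ,
    (λ j → proj₂ (∈-filter⁻ (nonOwnedOfSize? t A) {xs = allSubsets n} (proj₁ (proj₂ (preimage j))))) ,
    (λ j → proj₂ (proj₂ (preimage j)))
    where preimage = λ j → ∈-map⁻ (restrict A) (X∈G j)

  nonOwnedFamily-noDisjoint : ∀ {λ′ m s t′ A} → Frameproof (λ′ + m) s F → A ∈ˡ sets F → s ≤ λ′ + m →
    s * ∣ A ∣ ≡ t′ * (λ′ + m) + λ′ → t′ ≤ ∣ A ∣ → (∀ {S} → SubsetOfSize t′ A S → ¬ Owns A S) →
    NoDisjoint λ′ (s + 1) (λ′ + m ∸ s + 1) (nonOwnedFamily (suc t′) A)
  nonOwnedFamily-noDisjoint {λ′} {m} {s} {t′} {A} FP A∈F s≤λ′+m s*∣A∣≡ t′≤∣A∣ noSmallOwned (X , X∈G , disjoint) =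
    frameproof-violation FP A∈F T U (proj₁ ∘ proj₁ ∘ nonOwnedT) (proj₂ ∘ nonOwnedT) U⊆A
                         (λ j → noSmallOwned (U⊆A j , ∣U∣≡t′ j)) covered
    where
    preimages = nonOwnedFamily-members X X∈G
    T : Fin λ′ → Subset n
    T = proj₁ preimages
    nonOwnedT : ∀ j → NonOwnedOfSize (suc t′) A (T j)
    nonOwnedT = proj₁ (proj₂ preimages)
    completion = complete-cover {λ′ = λ′} {m} {t′} {s} {A} T
                   (proj₁ ∘ proj₁ ∘ nonOwnedT) (proj₂ ∘ proj₁ ∘ nonOwnedT) s*∣A∣≡
                   (Disjoint⇒cover-bounds {λ′ = λ′} {m} {s} {A} {T} {X} s≤λ′+m (proj₂ (proj₂ preimages)) disjoint)
                   t′≤∣A∣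
    U : Fin m → Subset n
    U = proj₁ completion
    U⊆A : ∀ j → U j ⊆ A
    U⊆A = proj₁ (proj₂ completion)
    ∣U∣≡t′ : ∀ j → ∣ U j ∣ ≡ t′
    ∣U∣≡t′ = proj₁ (proj₂ (proj₂ completion))
    covered : ∀ {i} → i ∈ A → s ≤ count i T + count i U
    covered = proj₂ (proj₂ (proj₂ completion))

  [kCt∸M]*t≤claimed : ∀ {λ′ m s t′ M A} → Frameproof (λ′ + m) s F → A ∈ˡ sets F → s ≤ λ′ + m →
    s * k ≡ t′ * (λ′ + m) + λ′ → t′ ≤ k → IsM k (suc t′) λ′ (s + 1) (λ′ + m ∸ s + 1) M →
    (k C suc t′ ∸ M) * suc t′ + t′ ≤ n →
    (k C suc t′ ∸ M) * suc t′ ≤ claimed (suc t′) A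
  [kCt∸M]*t≤claimed {λ′} {m} {s} {t′} {M} {A} FP A∈F s≤λ′+m s*k≡ t′≤k isM n₀
    with anySubset? (ownedOfSize? t′ A)
  ... | yes (S , (_ , ∣S∣≡t′) , ownsS) = ≤-trans (m+n≤o⇒m≤o∸n _ n₀) (Owns⇒n∸t′≤claimed ownsS ∣S∣≡t′)
  ... | no noSmallOwned = begin
    (k C suc t′ ∸ M) * suc t′      ≡⟨ cong (λ k → (k C suc t′ ∸ M) * suc t′) ∣A∣≡k ⟨
    (∣ A ∣ C suc t′ ∸ M) * suc t′  ≤⟨ *-monoˡ-≤ (suc t′) (m≤n+o⇒m∸n≤o _ M C≤M+owned) ⟩
    #owned (suc t′) A * suc t′     ≤⟨ #owned*t≤claimed (suc t′) A ⟩
    claimed (suc t′) A             ∎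
    where
    open ≤-Reasoning
    ∣A∣≡k : ∣ A ∣ ≡ k
    ∣A∣≡k = All.lookup (uniform F) A∈F
    #nonOwned≤M : #nonOwned (suc t′) A ≤ M
    #nonOwned≤M = subst (_≤ M) (∣nonOwnedFamily∣ (suc t′) A)
      (proj₂ (subst (λ k → IsM k (suc t′) λ′ (s + 1) (λ′ + m ∸ s + 1) M) (sym ∣A∣≡k) isM)
        (nonOwnedFamily (suc t′) A)
        (nonOwnedFamily-noDisjoint FP A∈F s≤λ′+m (subst (λ k → s * k ≡ t′ * (λ′ + m) + λ′) (sym ∣A∣≡k) s*k≡)
          (subst (t′ ≤_) (sym ∣A∣≡k) t′≤k) (λ {S} sized ownsS → noSmallOwned (S , sized , ownsS))))
    C≤M+owned : ∣ A ∣ C suc t′ ≤ M + #owned (suc t′) A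
    C≤M+owned = begin
      ∣ A ∣ C suc t′                           ≡⟨ #owned+#nonOwned≡C (suc t′) A ⟨
      #owned (suc t′) A + #nonOwned (suc t′) A ≤⟨ +-monoʳ-≤ (#owned (suc t′) A) #nonOwned≤M ⟩
      #owned (suc t′) A + M                    ≡⟨ +-comm (#owned (suc t′) A) M ⟩
      M + #owned (suc t′) A                    ∎

  frameproof-bound : ∀ {c λ′ m s t′ M} → c ≡ λ′ + m → Frameproof c s F → s ≤ c →
    s * k ≡ t′ * c + λ′ → t′ ≤ k → IsM k (suc t′) λ′ (s + 1) (c ∸ s + 1) M →
    (k C suc t′ ∸ M) * suc t′ + t′ ≤ n →
    length (sets F) * (k C suc t′ ∸ M) ≤ n C suc t′
  frameproof-bound {t′ = t′} {M} refl FP s≤c s*k≡ t′≤k isM n₀ = *-cancelʳ-≤ _ _ (suc t′) (begin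
    length (sets F) * D * suc t′        ≡⟨ *-assoc (length (sets F)) D (suc t′) ⟩
    length (sets F) * (D * suc t′)      ≡⟨ ∑ˡ-const (sets F) (D * suc t′) ⟨
    ∑[ A ∈ sets F ] (D * suc t′)        ≤⟨ ∑ˡ-mono-≤ (sets F) D*t≤claimed ⟩
    ∑[ A ∈ sets F ] claimed (suc t′) A  ≤⟨ ∑claimed≤nCt*t (suc t′) ⟩
    (n C suc t′) * suc t′               ∎)
    where
    open ≤-Reasoning
    D = k C suc t′ ∸ M
    D*t≤claimed : ∀ {A} → A ∈ˡ sets F → D * suc t′ ≤ claimed (suc t′) A
    D*t≤claimed A∈F = [kCt∸M]*t≤claimed FP A∈F s≤c s*k≡ t′≤k isM n₀

-- The parameter t

[r+q*d]/d≡q : ∀ {r d} q .{{_ : NonZero d}} → r < d → (r + q * d) / d ≡ q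
[r+q*d]/d≡q {r} {d} q r<d = begin
  (r + q * d) / d    ≡⟨ +-distrib-/-∣ʳ r (n∣m*n q) ⟩
  r / d + q * d / d  ≡⟨ cong₂ _+_ (m<n⇒m/n≡0 r<d) (m*n/n≡m q d) ⟩
  q                  ∎
  where open ≡-Reasoning

residue⇒quotient : ∀ {a c λ′} → 1 ≤ a → λ′ ≤ c → λ′ ≡ a [mod c ] → ∃ λ q → λ′ + q * c ≡ a
residue⇒quotient _ _ (q , inj₁ λ′+qc≡a) = q , λ′+qc≡a
residue⇒quotient {a} _ _ (zero , inj₂ a+0≡λ′) =
  0 , trans (+-identityʳ _) (sym (trans (sym (+-identityʳ a)) a+0≡λ′))
residue⇒quotient {a} {c} {λ′} 1≤a λ′≤c (suc q , inj₂ a+[1+q]c≡λ′) = contradiction λ′≤c (<⇒≱ (begin-strict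
  c              <⟨ n<1+n c ⟩
  1 + c          ≤⟨ +-mono-≤ 1≤a (m≤m+n c (q * c)) ⟩
  a + suc q * c  ≡⟨ a+[1+q]c≡λ′ ⟩
  λ′             ∎))
  where open ≤-Reasoning

ceilDiv-quotient : ∀ {c λ′} q → 1 ≤ λ′ → λ′ ≤ c → ceilDiv (λ′ + q * c) c ≡ suc q
ceilDiv-quotient {suc c′} {suc r} q _ λ′≤c = begin
  (suc r + q * suc c′ + c′) / suc c′  ≡⟨ cong (_/ suc c′) (shift r q c′) ⟩
  (r + suc q * suc c′) / suc c′       ≡⟨ [r+q*d]/d≡q (suc q) λ′≤c ⟩
  suc q                               ∎
  where
  open ≡-Reasoning
  shift : ∀ r q c′ → suc r + q * suc c′ + c′ ≡ r + suc q * suc c′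
  shift = solve-∀

theorem2p2 : (n k c s t λ' M : ℕ) →
    2 ≤ k → k ≤ n → 2 ≤ c → 1 ≤ s → s + 1 ≤ c →
    t ≡ ceilDiv (s * k) c →
    1 ≤ λ' → λ' ≤ c → λ' ≡ s * k [mod c ] →
    IsM k t λ' (s + 1) (c ∸ s + 1) M →
    (k C t ∸ M) * t + t ∸ 1 ≤ n →
    (F : Family n k) → Frameproof c s F →
    length (sets F) * (k C t ∸ M) ≤ n C t
theorem2p2 n k c s t λ′ M 2≤k _ _ 1≤s s+1≤c t≡ 1≤λ′ λ′≤c λ′≡sk isM n₀ F FP
  with t′ , λ′+t′c≡sk ← residue⇒quotient (*-mono-≤ 1≤s (≤-trans (s≤s z≤n) 2≤k)) λ′≤c λ′≡sk
  with refl ← trans t≡ (trans (cong (λ a → ceilDiv a c) (sym λ′+t′c≡sk)) (ceilDiv-quotient t′ 1≤λ′ λ′≤c))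
  = Claiming.frameproof-bound F (sym (m+[n∸m]≡n λ′≤c)) FP s≤c sk≡ t′≤k isM n₀′
  where
  instance
    c≢0 : NonZero c
    c≢0 = >-nonZero (≤-trans 1≤λ′ λ′≤c)
  s≤c : s ≤ c
  s≤c = ≤-trans (m≤m+n s 1) s+1≤c
  sk≡ : s * k ≡ t′ * c + λ′
  sk≡ = trans (sym λ′+t′c≡sk) (+-comm λ′ (t′ * c))
  t′≤k : t′ ≤ k
  t′≤k = *-cancelʳ-≤ t′ k c (begin
    t′ * c       ≤⟨ m≤m+n (t′ * c) λ′ ⟩
    t′ * c + λ′  ≡⟨ sk≡ ⟨
    s * k        ≤⟨ *-monoˡ-≤ k s≤c ⟩
    c * k        ≡⟨ *-comm c k ⟩
    k * c        ∎)
    where open ≤-Reasoning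
  n₀′ : (k C suc t′ ∸ M) * suc t′ + t′ ≤ n
  n₀′ = subst (_≤ n) (cong (_∸ 1) (+-suc _ t′)) n₀
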